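{- Let $\Gamma$ be a strictly Deza graph with parameters $(n,k,b,a)$ such that $k=b+1$ and $\beta(\Gamma)>1$. Let $x$ be a vertex of type (A). Then the subgraph of $\Gamma$ induced on $B[x]=B(x)\cup\{x\}$ is a coclique (independent set) of size $\beta(\Gamma)+1$.
   Context: Graphs are finite, simple, undirected. $N(v)$ is the neighbourhood of $v$. A Deza graph with parameters $(n,k,b,a)$, $b\ge a$, is a nonempty $k$-regular graph on $n$ vertices in which every pair of distinct vertices has exactly $b$ or exactly $a$ common neighbours; it is strictly Deza if it has diameter $2$ and is not strongly regular. $B(v)=\{u: |N(u)\cap N(v)|=b\}$, $B[v]=B(v)\cup\{v\}$; $\beta(\Gamma)=|B(v)|$ (independent of $v$). A vertex $v$ is of type (A) if $B(v)\cap N(v)=\emptyset$. -}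

module Defs where

open import Data.Nat using (ℕ; zero; suc; _+_; _≤_; _<_; _≡ᵇ_)
open import Data.Bool using (Bool; true; false; _∧_; not; if_then_else_)
open import Data.Fin using (Fin; _≟_)
open import Data.List using (List; map; allFin)
open import Data.Nat.ListAction using (sum)
open import Data.Product using (Σ; ∃; _×_; _,_)
open import Data.Sum using (_⊎_)
open import Relation.Nullary using (¬_; does)
open import Relation.Binary.PropositionalEquality using (_≡_; _≢_)

record Graph (n : ℕ) : Set where
  field
    adj   : Fin n → Fin n → Bool
    sym   : ∀ u v → adj u v ≡ adj v u
    irref : ∀ v → adj v v ≡ false

open Graph public

count : {n : ℕ} → (Fin n → Bool) → ℕ
count {n} p = sum (map (λ i → if p i then 1 else 0) (allFin n))

Adj : {n : ℕ} → Graph n → Fin n → Fin n → Set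
Adj G u v = adj G u v ≡ true

deg : {n : ℕ} → Graph n → Fin n → ℕ
deg G v = count (adj G v)

common : {n : ℕ} → Graph n → Fin n → Fin n → ℕ
common G u v = count (λ w → adj G u w ∧ adj G v w)

IsDeza : {n : ℕ} → Graph n → ℕ → ℕ → ℕ → Set
IsDeza {n} G k b a =
  (0 < n) × (a ≤ b) × (∀ v → deg G v ≡ k) ×
  (∀ u v → u ≢ v → (common G u v ≡ b) ⊎ (common G u v ≡ a))

Dist≤2 : {n : ℕ} → Graph n → Fin n → Fin n → Set
Dist≤2 G u v = (u ≡ v) ⊎ Adj G u v ⊎ (∃ λ w → Adj G u w × Adj G w v)

HasDiameter2 : {n : ℕ} → Graph n → Set
HasDiameter2 G =
  (∀ u v → Dist≤2 G u v) × (∃ λ u → ∃ λ v → u ≢ v × ¬ Adj G u v)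

IsSRG : {n : ℕ} → Graph n → ℕ → ℕ → ℕ → Set
IsSRG G k l m =
  (∀ v → deg G v ≡ k) ×
  (∀ u v → u ≢ v → Adj G u v → common G u v ≡ l) ×
  (∀ u v → u ≢ v → ¬ Adj G u v → common G u v ≡ m)

IsStronglyRegular : {n : ℕ} → Graph n → Set
IsStronglyRegular G = ∃ λ k → ∃ λ l → ∃ λ m → IsSRG G k l m

IsStrictlyDeza : {n : ℕ} → Graph n → ℕ → ℕ → ℕ → Set
IsStrictlyDeza G k b a = IsDeza G k b a × HasDiameter2 G × ¬ IsStronglyRegular G

inB : {n : ℕ} → Graph n → ℕ → Fin n → Fin n → Bool
inB G b v u = not (does (u ≟ v)) ∧ (common G u v ≡ᵇ b)

inB[] : {n : ℕ} → Graph n → ℕ → Fin n → Fin n → Bool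
inB[] G b v u = does (u ≟ v) Data.Bool.∨ inB G b v u

beta : {n : ℕ} → Graph n → ℕ → Fin n → ℕ
beta G b v = count (inB G b v)

TypeA : {n : ℕ} → Graph n → ℕ → Fin n → Set
TypeA G b v = ∀ u → inB G b v u ≡ true → adj G v u ≡ false

IsCoclique : {n : ℕ} → Graph n → (Fin n → Bool) → Set
IsCoclique G S = ∀ u w → S u ≡ true → S w ≡ true → adj G u w ≡ false

-- Since k = b + 1, a vertex u ∈ B(x) shares all but one neighbour with x: N(x) ∖ N(u) = {p} and
-- N(u) ∖ N(x) is a single vertex. Suppose u, w ∈ B(x) are adjacent. As x has type (A), w ∉ N(x),
-- so N(u) = N(x) − p + w, and likewise N(w) = N(x) − q + u.
-- If p = q, a neighbour z ≠ p of x not adjacent to p would satisfy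
-- |N(z) ∩ N(u)| = |N(z) ∩ N(x)| + 1, while both sides equal a because z has two neighbours
-- (among x, u) outside N(u), resp. N(x). So p is adjacent to all of N(x) − p, i.e. p ∈ B(x) ∩ N(x),
-- contradicting type (A).
-- If p ≠ q, then N(u) ∩ N(w) = N(x) − p − q has b − 1 elements, so a = b − 1. A vertex z of
-- N(x) − p − q would have the three neighbours x, u, w outside N(x), leaving at most b − 2 common
-- neighbours with x. Hence N(x) = {p, q}, and Γ is a Deza graph with parameters (n, 2, 1, 0) and
-- diameter 2, which is strongly regular.
module Submission where

open import Algebra.Properties.CommutativeSemigroup using (interchange)
open import Data.Bool using (Bool; true; false; _∧_; not; if_then_else_)
open import Data.Bool.Properties
  using (∧-identityʳ; ∧-zeroʳ; ∧-comm; ∧-conicalˡ; ∧-conicalʳ; not-involutive; ¬-not; T-≡)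
open import Data.Empty using (⊥; ⊥-elim)
open import Data.Fin as Fin using (Fin; _≟_)
open import Data.List.Properties using (map-tabulate)
open import Data.Nat using (ℕ; zero; suc; _+_; _≤_; _<_; z≤n; s≤s)
open import Data.Nat.ListAction using (sum)
open import Data.Nat.Properties
  using ( ≡ᵇ⇒≡; ≡⇒≡ᵇ; suc-injective; 1+n≰n; 1+n≢n; n≤1+n; ≤-reflexive
        ; +-comm; +-suc; +-cancelˡ-≡; +-monoˡ-≤; +-monoʳ-≤; +-commutativeSemigroup; module ≤-Reasoning)
open import Data.Product using (∃; _×_; _,_; proj₁; proj₂)
open import Data.Sum using (_⊎_; inj₁; inj₂)
open import Function using (_∘_; id; Equivalence)
open import Relation.Nullary using (¬_; does; yes; no)
open import Relation.Binary.PropositionalEquality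
open import Defs renaming (sym to adj-sym)

private
  variable
    n : ℕ

true≢false : true ≢ false
true≢false ()

not≡true : {p : Bool} → not p ≡ true → p ≡ false
not≡true {p} ¬p = trans (sym (not-involutive p)) (cong not ¬p)

infix 4 _==_
_==_ : Fin n → Fin n → Bool
i == j = does (i ≟ j)

==-≢ : {i j : Fin n} → i ≢ j → (i == j) ≡ false
==-≢ {i = i} {j = j} i≢j with i ≟ j
... | yes i≡j = ⊥-elim (i≢j i≡j)
... | no _ = refl

delete : Fin n → (Fin n → Bool) → Fin n → Bool
delete j P i = P i ∧ not (i == j)

delete-≢ : (P : Fin n → Bool) {i j : Fin n} → i ≢ j → delete j P i ≡ P i
delete-≢ P {i} i≢j rewrite ==-≢ i≢j = ∧-identityʳ (P i)

delete-elim : (P : Fin n → Bool) {i j : Fin n} → delete j P i ≡ true → P i ≡ true × i ≢ j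
delete-elim P {i} {j} Pi∧i≢j with P i | i ≟ j
... | true | no i≢j = refl , i≢j

indicator : Bool → ℕ
indicator p = if p then 1 else 0

count-suc : (P : Fin (suc n) → Bool) → count P ≡ indicator (P Fin.zero) + count (P ∘ Fin.suc)
count-suc P = cong (λ xs → indicator (P Fin.zero) + sum xs)
  (trans (map-tabulate Fin.suc (indicator ∘ P)) (sym (map-tabulate id (indicator ∘ P ∘ Fin.suc))))

count-cong : {P Q : Fin n → Bool} → (∀ i → P i ≡ Q i) → count P ≡ count Q
count-cong {zero} P≗Q = refl
count-cong {suc n} {P} {Q} P≗Q = begin
  count P                                          ≡⟨ count-suc P ⟩
  indicator (P Fin.zero) + count (P ∘ Fin.suc)     ≡⟨ cong₂ _+_ (cong indicator (P≗Q Fin.zero)) (count-cong (P≗Q ∘ Fin.suc)) ⟩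
  indicator (Q Fin.zero) + count (Q ∘ Fin.suc)     ≡⟨ count-suc Q ⟨
  count Q                                          ∎
  where open ≡-Reasoning

indicator-split : (p q : Bool) → indicator p ≡ indicator (p ∧ q) + indicator (p ∧ not q)
indicator-split false q     = refl
indicator-split true  false = refl
indicator-split true  true  = refl

count-split : (P Q : Fin n → Bool) →
  count P ≡ count (λ i → P i ∧ Q i) + count (λ i → P i ∧ not (Q i))
count-split {zero}  P Q = refl
count-split {suc n} P Q = begin
  count P
    ≡⟨ count-suc P ⟩
  indicator P₀ + count (P ∘ Fin.suc)
    ≡⟨ cong₂ _+_ (indicator-split P₀ Q₀) (count-split (P ∘ Fin.suc) (Q ∘ Fin.suc)) ⟩
  (indicator (P₀ ∧ Q₀) + indicator (P₀ ∧ not Q₀)) + (count (PQ ∘ Fin.suc) + count (PQ̅ ∘ Fin.suc))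
    ≡⟨ interchange +-commutativeSemigroup (indicator (P₀ ∧ Q₀)) _ _ _ ⟩
  (indicator (P₀ ∧ Q₀) + count (PQ ∘ Fin.suc)) + (indicator (P₀ ∧ not Q₀) + count (PQ̅ ∘ Fin.suc))
    ≡⟨ cong₂ _+_ (count-suc PQ) (count-suc PQ̅) ⟨
  count PQ + count PQ̅
    ∎
  where
  open ≡-Reasoning
  P₀ Q₀ : Bool
  P₀ = P Fin.zero
  Q₀ = Q Fin.zero
  PQ PQ̅ : Fin (suc n) → Bool
  PQ  i = P i ∧ Q i
  PQ̅ i = P i ∧ not (Q i)

count-≡0 : {P : Fin n → Bool} → (∀ i → P i ≡ false) → count P ≡ 0
count-≡0 {zero}      P≗false = refl
count-≡0 {suc n} {P} P≗false
  rewrite count-suc P | P≗false Fin.zero = count-≡0 (P≗false ∘ Fin.suc)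

count-delete : (P : Fin n → Bool) {j : Fin n} → P j ≡ true → count P ≡ suc (count (delete j P))
count-delete P {Fin.zero} Pj
  rewrite count-suc P | count-suc (delete Fin.zero P) | Pj
  = cong suc (count-cong (λ i → sym (∧-identityʳ (P (Fin.suc i)))))
count-delete P {Fin.suc j} Pj
  rewrite count-suc P | count-suc (delete (Fin.suc j) P) | ∧-identityʳ (P Fin.zero)
  = trans (cong (indicator (P Fin.zero) +_) (count-delete (P ∘ Fin.suc) Pj))
          (+-suc (indicator (P Fin.zero)) _)

count-pos : (P : Fin n → Bool) {j : Fin n} → P j ≡ true → 0 < count P
count-pos P Pj rewrite count-delete P Pj = s≤s z≤n

count-witness : (P : Fin n → Bool) → 0 < count P → ∃ λ i → P i ≡ true
count-witness {suc n} P pos with P Fin.zero in P₀ | subst (0 <_) (count-suc P) pos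
... | true  | _    = Fin.zero , P₀
... | false | pos′ with i , Pi ← count-witness (P ∘ Fin.suc) pos′ = Fin.suc i , Pi

==-refl : (i : Fin n) → (i == i) ≡ true
==-refl i with i ≟ i
... | yes _   = refl
... | no i≢i = ⊥-elim (i≢i refl)

count-≡1 : (P : Fin n → Bool) {j : Fin n} → P j ≡ true → (∀ i → P i ≡ true → i ≡ j) → count P ≡ 1
count-≡1 P {j} Pj only = trans (count-delete P Pj) (cong suc (count-≡0 notOther))
  where
  notOther : ∀ i → delete j P i ≡ false
  notOther i with P i in Pi
  ... | false = refl
  ... | true rewrite only i Pi | ==-refl j = refl

count-≡1-unique : (P : Fin n → Bool) {i j : Fin n} → count P ≡ 1 → P i ≡ true → P j ≡ true → i ≡ j
count-≡1-unique P {i} {j} count≡1 Pi Pj with i ≟ j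
... | yes i≡j = i≡j
... | no i≢j with () ← subst (0 <_) (suc-injective (trans (sym (count-delete P Pi)) count≡1))
                               (count-pos (delete i P) (trans (delete-≢ P (i≢j ∘ sym)) Pj))

count-≥2 : (P : Fin n → Bool) {i j : Fin n} → P i ≡ true → P j ≡ true → i ≢ j → 2 ≤ count P
count-≥2 P {i} {j} Pi Pj i≢j rewrite count-delete P Pi =
  s≤s (count-pos (delete i P) (trans (delete-≢ P (i≢j ∘ sym)) Pj))

count-≥3 : (P : Fin n → Bool) {i j l : Fin n} → P i ≡ true → P j ≡ true → P l ≡ true →
  i ≢ j → i ≢ l → j ≢ l → 3 ≤ count P
count-≥3 P {i} {j} {l} Pi Pj Pl i≢j i≢l j≢l rewrite count-delete P Pi =
  s≤s (count-≥2 (delete i P) (trans (delete-≢ P (i≢j ∘ sym)) Pj) (trans (delete-≢ P (i≢l ∘ sym)) Pl) j≢l)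

count-≡2-elim : (P : Fin n → Bool) {i j l : Fin n} → count P ≡ 2 → P i ≡ true → P j ≡ true → i ≢ j →
  P l ≡ true → l ≡ i ⊎ l ≡ j
count-≡2-elim P {i} {j} {l} count≡2 Pi Pj i≢j Pl with l ≟ i
... | yes l≡i = inj₁ l≡i
... | no l≢i = inj₂ (count-≡1-unique (delete i P) (suc-injective (trans (sym (count-delete P Pi)) count≡2))
                       (trans (delete-≢ P l≢i) Pl) (trans (delete-≢ P (i≢j ∘ sym)) Pj))

Private : Graph n → Fin n → Fin n → Fin n → Bool
Private G u v y = adj G u y ∧ not (adj G v y)

module _ (G : Graph n) where

  Adj-sym : {u v : Fin n} → Adj G u v → Adj G v u
  Adj-sym {u} {v} uv = trans (adj-sym G v u) uv

  Adj-≢ : {u v : Fin n} → Adj G u v → u ≢ v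
  Adj-≢ {u} uv refl = true≢false (trans (sym uv) (irref G u))

  private-intro : {u v y : Fin n} → Adj G u y → adj G v y ≡ false → Private G u v y ≡ true
  private-intro uy vy rewrite uy | vy = refl

  private-elim : {u v y : Fin n} → Private G u v y ≡ true → Adj G u y × adj G v y ≡ false
  private-elim {u} {v} {y} _ with true ← adj G u y | false ← adj G v y = refl , refl

  common-sym : (u v : Fin n) → common G u v ≡ common G v u
  common-sym u v = count-cong (λ y → ∧-comm (adj G u y) (adj G v y))

  common-pos : {u v w : Fin n} → Adj G u w → Adj G v w → 0 < common G u v
  common-pos {u} {v} {w} uw vw = count-pos (λ y → adj G u y ∧ adj G v y) (cong₂ _∧_ uw vw)

  common-witness : (u v : Fin n) → 0 < common G u v → ∃ λ w → Adj G u w × Adj G v w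
  common-witness u v pos with w , uw∧vw ← count-witness (λ y → adj G u y ∧ adj G v y) pos =
    w , ∧-conicalˡ _ _ uw∧vw , ∧-conicalʳ _ _ uw∧vw

  common-+-private : (u v : Fin n) → common G u v + count (Private G u v) ≡ deg G u
  common-+-private u v = sym (count-split (adj G u) (adj G v))

module Regular (G : Graph n) (b : ℕ) (regular : ∀ v → deg G v ≡ suc b) where

  common≡b⇒private-count≡1 : {u v : Fin n} → common G u v ≡ b → count (Private G u v) ≡ 1
  common≡b⇒private-count≡1 {u} {v} uv≡b = +-cancelˡ-≡ b _ 1 (begin
    b + count (Private G u v)               ≡⟨ cong (_+ _) uv≡b ⟨
    common G u v + count (Private G u v)    ≡⟨ common-+-private G u v ⟩
    deg G u                                 ≡⟨ regular u ⟩
    suc b                                   ≡⟨ +-comm 1 b ⟩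
    b + 1                                   ∎)
    where open ≡-Reasoning

  private-exists : {u v : Fin n} → common G u v ≡ b → ∃ λ p → Adj G u p × adj G v p ≡ false
  private-exists {u} {v} uv≡b
    with p , Pp ← count-witness (Private G u v) (subst (0 <_) (sym (common≡b⇒private-count≡1 uv≡b)) (s≤s z≤n))
    = p , private-elim G Pp

  private-unique : {u v c d : Fin n} → common G u v ≡ b →
    Adj G u c → adj G v c ≡ false → Adj G u d → adj G v d ≡ false → c ≡ d
  private-unique uv≡b uc vc ud vd =
    count-≡1-unique _ (common≡b⇒private-count≡1 uv≡b) (private-intro G uc vc) (private-intro G ud vd)

  adjacent-unless-private : {u v p y : Fin n} → common G u v ≡ b →
    Adj G u p → adj G v p ≡ false → Adj G u y → y ≢ p → Adj G v y
  adjacent-unless-private {v = v} {y = y} uv≡b up vp uy y≢p with adj G v y in vy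
  ... | true  = refl
  ... | false = ⊥-elim (y≢p (private-unique uv≡b uy vy up vp))

  common-+-private-≤ : {u v : Fin n} {m : ℕ} → m ≤ count (Private G u v) → common G u v + m ≤ suc b
  common-+-private-≤ {u} {v} {m} m≤ =
    subst (common G u v + m ≤_) (trans (common-+-private G u v) (regular u)) (+-monoʳ-≤ (common G u v) m≤)

  dominating⇒common≡b : {v p : Fin n} → Adj G v p → (∀ y → Adj G v y → y ≢ p → Adj G p y) → common G p v ≡ b
  dominating⇒common≡b {v} {p} vp dominates =
    suc-injective (trans (cong suc (count-cong restOfN[v])) (trans (sym (count-delete (adj G v) vp)) (regular v)))
    where
    restOfN[v] : ∀ y → (adj G p y ∧ adj G v y) ≡ delete p (adj G v) y
    restOfN[v] y with adj G v y in vy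
    ... | false = ∧-zeroʳ (adj G p y)
    ... | true with y ≟ p
    ...   | yes refl rewrite irref G p = refl
    ...   | no y≢p  rewrite dominates y vy y≢p = refl

-- A triangle would be closed under adjacency, hence by diameter 2 the whole graph, which would
-- then be complete.
deza[2,1,0]⇒srg : {G : Graph n} → IsDeza G 2 1 0 → HasDiameter2 G → IsSRG G 2 0 1
deza[2,1,0]⇒srg {n} {G} (_ , _ , regular , one-or-zero) (dist≤2 , s , r , s≢r , s≁r) =
  regular , adjacent⇒common≡0 , nonadjacent⇒common≡1
  where
  triangle-closed : {u v t z : Fin n} → Adj G u v → Adj G u t → Adj G v t → Adj G u z → z ≡ v ⊎ z ≡ t
  triangle-closed {u} uv ut vt uz = count-≡2-elim (adj G u) (regular u) uv ut (Adj-≢ G vt) uz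

  no-triangle : {y v t : Fin n} → Adj G y v → Adj G y t → Adj G v t → ⊥
  no-triangle {y} {v} {t} yv yt vt = s≁r (complete (reach s) (reach r) s≢r)
    where
    N[y] : Fin n → Set
    N[y] z = z ≡ y ⊎ Adj G y z

    reach : ∀ z → N[y] z
    reach z with dist≤2 y z
    ... | inj₁ refl = inj₁ refl
    ... | inj₂ (inj₁ yz) = inj₂ yz
    ... | inj₂ (inj₂ (m , ym , mz)) with triangle-closed yv yt vt ym
    ...   | inj₁ refl with triangle-closed (Adj-sym G yv) vt yt mz
    ...     | inj₁ refl = inj₁ refl
    ...     | inj₂ refl = inj₂ yt
    reach z | inj₂ (inj₂ (m , ym , mz)) | inj₂ refl with triangle-closed (Adj-sym G yt) (Adj-sym G vt) yv mz
    ...     | inj₁ refl = inj₁ refl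
    ...     | inj₂ refl = inj₂ yv

    complete : {z z′ : Fin n} → N[y] z → N[y] z′ → z ≢ z′ → Adj G z z′
    complete (inj₁ refl) (inj₁ refl) z≢z′ = ⊥-elim (z≢z′ refl)
    complete (inj₁ refl) (inj₂ yz′)  _    = yz′
    complete (inj₂ yz)  (inj₁ refl) _    = Adj-sym G yz
    complete (inj₂ yz)  (inj₂ yz′)  z≢z′ with triangle-closed yv yt vt yz | triangle-closed yv yt vt yz′
    ... | inj₁ refl | inj₁ refl = ⊥-elim (z≢z′ refl)
    ... | inj₁ refl | inj₂ refl = vt
    ... | inj₂ refl | inj₁ refl = Adj-sym G vt
    ... | inj₂ refl | inj₂ refl = ⊥-elim (z≢z′ refl)

  adjacent⇒common≡0 : ∀ u v → u ≢ v → Adj G u v → common G u v ≡ 0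
  adjacent⇒common≡0 u v u≢v uv with one-or-zero u v u≢v
  ... | inj₂ ≡0 = ≡0
  ... | inj₁ ≡1 with t , ut , vt ← common-witness G u v (subst (0 <_) (sym ≡1) (s≤s z≤n)) =
    ⊥-elim (no-triangle uv ut vt)

  nonadjacent⇒common≡1 : ∀ u v → u ≢ v → ¬ Adj G u v → common G u v ≡ 1
  nonadjacent⇒common≡1 u v u≢v u≁v with dist≤2 u v | one-or-zero u v u≢v
  ... | _                          | inj₁ ≡1 = ≡1
  ... | inj₁ u≡v                   | _       = ⊥-elim (u≢v u≡v)
  ... | inj₂ (inj₁ uv)             | _       = ⊥-elim (u≁v uv)
  ... | inj₂ (inj₂ (m , um , mv)) | inj₂ ≡0 with () ← subst (0 <_) ≡0 (common-pos G um (Adj-sym G mv))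

module _ (G : Graph n) (b : ℕ) where

  inB-intro : {v u : Fin n} → u ≢ v → common G u v ≡ b → inB G b v u ≡ true
  inB-intro u≢v uv≡b rewrite ==-≢ u≢v | uv≡b = Equivalence.to T-≡ (≡⇒≡ᵇ b b refl)

  inB-elim : (v u : Fin n) → inB G b v u ≡ true → u ≢ v × common G u v ≡ b
  inB-elim v u u∈B with u ≟ v
  ... | no u≢v = u≢v , ≡ᵇ⇒≡ _ _ (Equivalence.from T-≡ u∈B)

  inB[]-elim : (v u : Fin n) → inB[] G b v u ≡ true → u ≡ v ⊎ inB G b v u ≡ true
  inB[]-elim v u u∈B[] with u ≟ v
  ... | yes u≡v = inj₁ u≡v
  ... | no _    = inj₂ u∈B[]

  count-inB[] : (v : Fin n) → count (inB[] G b v) ≡ beta G b v + 1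
  count-inB[] v = trans (count-delete (inB[] G b v) v∈B[v]) (trans (cong suc (count-cong B[v]∖v≗B)) (+-comm 1 _))
    where
    v∈B[v] : inB[] G b v v ≡ true
    v∈B[v] rewrite ==-refl v = refl

    B[v]∖v≗B : ∀ u → delete v (inB[] G b v) u ≡ inB G b v u
    B[v]∖v≗B u with u ≟ v
    ... | yes _ = refl
    ... | no _  = ∧-identityʳ _

module TypeAVertex {G : Graph n} {b a : ℕ}
  (deza : IsDeza G (suc b) b a) (diameter2 : HasDiameter2 G) (notSRG : ¬ IsStronglyRegular G)
  (x : Fin n) (typeA : TypeA G b x) where

  regular : ∀ v → deg G v ≡ suc b
  regular = proj₁ (proj₂ (proj₂ deza))

  b-or-a : ∀ u v → u ≢ v → common G u v ≡ b ⊎ common G u v ≡ a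
  b-or-a = proj₂ (proj₂ (proj₂ deza))

  open Regular G b regular

  two-private⇒common≡a : {u v c d : Fin n} → u ≢ v →
    Adj G u c → adj G v c ≡ false → Adj G u d → adj G v d ≡ false → c ≢ d → common G u v ≡ a
  two-private⇒common≡a {u} {v} u≢v uc vc ud vd c≢d with b-or-a u v u≢v
  ... | inj₂ uv≡a = uv≡a
  ... | inj₁ uv≡b = ⊥-elim (1+n≰n (subst (_≤ suc b) (+-comm b 2) b+2≤1+b))
    where
    b+2≤1+b : b + 2 ≤ suc b
    b+2≤1+b = subst (λ m → m + 2 ≤ suc b) uv≡b
      (common-+-private-≤ (count-≥2 _ (private-intro G uc vc) (private-intro G ud vd) c≢d))

  B-nonadjacent-to-x : {u : Fin n} → u ≢ x → common G u x ≡ b → adj G x u ≡ false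
  B-nonadjacent-to-x u≢x ux≡b = typeA _ (inB-intro G b u≢x ux≡b)

  module _ {u w : Fin n} (u≢x : u ≢ x) (w≢x : w ≢ x) (ux≡b : common G u x ≡ b) (wx≡b : common G w x ≡ b)
           (uw : Adj G u w) where

    private
      x≁u : adj G x u ≡ false
      x≁u = B-nonadjacent-to-x u≢x ux≡b

      x≁w : adj G x w ≡ false
      x≁w = B-nonadjacent-to-x w≢x wx≡b

      xu≡b : common G x u ≡ b
      xu≡b = trans (common-sym G x u) ux≡b

      xw≡b : common G x w ≡ b
      xw≡b = trans (common-sym G x w) wx≡b

    shared-private⇒⊥ : {p : Fin n} → Adj G x p → adj G u p ≡ false → adj G w p ≡ false → ⊥
    shared-private⇒⊥ {p} xp u≁p w≁p = true≢false (trans (sym xp) (typeA p (inB-intro G b p≢x px≡b)))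
      where
      p≢x : p ≢ x
      p≢x = Adj-≢ G xp ∘ sym

      u-adj : {y : Fin n} → Adj G x y → y ≢ p → Adj G u y
      u-adj = adjacent-unless-private xu≡b xp u≁p

      w-adj : {y : Fin n} → Adj G x y → y ≢ p → Adj G w y
      w-adj = adjacent-unless-private xw≡b xp w≁p

      common-zu≡suc-common-zx : {z : Fin n} → Adj G x z → z ≢ p → adj G z p ≡ false → common G z u ≡ suc (common G z x)
      common-zu≡suc-common-zx {z} xz z≢p z≁p = begin
        common G z u
          ≡⟨ count-split (λ y → adj G z y ∧ adj G u y) (adj G x) ⟩
        count (λ y → (adj G z y ∧ adj G u y) ∧ adj G x y) + count (λ y → (adj G z y ∧ adj G u y) ∧ not (adj G x y))
          ≡⟨ cong₂ _+_ (count-cong agree-on-N[x]) (count-≡1 _ w-private only-w-private) ⟩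
        common G z x + 1
          ≡⟨ +-comm _ 1 ⟩
        suc (common G z x)
          ∎
        where
        open ≡-Reasoning
        agree-on-N[x] : ∀ y → ((adj G z y ∧ adj G u y) ∧ adj G x y) ≡ (adj G z y ∧ adj G x y)
        agree-on-N[x] y with adj G x y in xy
        ... | false = trans (∧-zeroʳ _) (sym (∧-zeroʳ _))
        ... | true with y ≟ p
        ...   | yes refl rewrite z≁p = refl
        ...   | no y≢p  rewrite u-adj xy y≢p = cong (_∧ true) (∧-identityʳ (adj G z y))
        w-private : ((adj G z w ∧ adj G u w) ∧ not (adj G x w)) ≡ true
        w-private rewrite Adj-sym G (w-adj xz z≢p) | uw | x≁w = refl
        only-w-private : ∀ y → ((adj G z y ∧ adj G u y) ∧ not (adj G x y)) ≡ true → y ≡ w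
        only-w-private y e =
          private-unique ux≡b (∧-conicalʳ (adj G z y) _ (∧-conicalˡ _ _ e))
                              (not≡true (∧-conicalʳ (adj G z y ∧ adj G u y) _ e)) uw x≁w

      p-dominates : ∀ z → Adj G x z → z ≢ p → Adj G p z
      p-dominates z xz z≢p with adj G p z in pz
      ... | true  = refl
      ... | false = ⊥-elim (1+n≢n (begin
        suc a                ≡⟨ cong suc zx≡a ⟨
        suc (common G z x)   ≡⟨ common-zu≡suc-common-zx xz z≢p (trans (adj-sym G z p) pz) ⟨
        common G z u         ≡⟨ zu≡a ⟩
        a                    ∎))
        where
        open ≡-Reasoning
        zx : Adj G z x
        zx = Adj-sym G xz
        zu : Adj G z u
        zu = Adj-sym G (u-adj xz z≢p)
        zu≡a : common G z u ≡ a
        zu≡a = two-private⇒common≡a (Adj-≢ G zu) zu (irref G u) zx (trans (adj-sym G u x) x≁u) u≢x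
        zx≡a : common G z x ≡ a
        zx≡a = two-private⇒common≡a (Adj-≢ G zx) zx (irref G x) zu x≁u (u≢x ∘ sym)

      px≡b : common G p x ≡ b
      px≡b = dominating⇒common≡b xp p-dominates

    module _ {p q : Fin n} (xp : Adj G x p) (u≁p : adj G u p ≡ false) (xq : Adj G x q) (w≁q : adj G w q ≡ false)
             (p≢q : p ≢ q) where

      private
        u-adj : {y : Fin n} → Adj G x y → y ≢ p → Adj G u y
        u-adj = adjacent-unless-private xu≡b xp u≁p

        w-adj : {y : Fin n} → Adj G x y → y ≢ q → Adj G w y
        w-adj = adjacent-unless-private xw≡b xq w≁q

        N[x]∖pq : Fin n → Bool
        N[x]∖pq = delete q (delete p (adj G x))

        N[u]∩N[w]≗N[x]∖pq : ∀ y → (adj G u y ∧ adj G w y) ≡ N[x]∖pq y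
        N[u]∩N[w]≗N[x]∖pq y with adj G x y in xy
        ... | false with adj G u y in uy
        ...   | false = refl
        ...   | true  = subst (λ t → adj G w t ≡ false) (sym (private-unique ux≡b uy xy uw x≁w)) (irref G w)
        N[u]∩N[w]≗N[x]∖pq y | true with y ≟ p
        ... | yes refl rewrite u≁p = refl
        ... | no y≢p with y ≟ q
        ...   | yes refl rewrite u-adj xy y≢p | w≁q = refl
        ...   | no y≢q  rewrite u-adj xy y≢p | w-adj xy y≢q = refl

        uw≡size : common G u w ≡ count N[x]∖pq
        uw≡size = count-cong N[u]∩N[w]≗N[x]∖pq

        N[x]∖pq-size : suc (suc (count N[x]∖pq)) ≡ suc b
        N[x]∖pq-size = begin
          suc (suc (count N[x]∖pq))
            ≡⟨ cong suc (count-delete (delete p (adj G x)) (trans (delete-≢ (adj G x) (p≢q ∘ sym)) xq)) ⟨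
          suc (count (delete p (adj G x)))
            ≡⟨ count-delete (adj G x) xp ⟨
          deg G x
            ≡⟨ regular x ⟩
          suc b
            ∎
          where open ≡-Reasoning

        uw≡a : common G u w ≡ a
        uw≡a with b-or-a u w (Adj-≢ G uw)
        ... | inj₂ uw≡a = uw≡a
        ... | inj₁ uw≡b = ⊥-elim (1+n≢n (suc-injective (trans N[x]∖pq-size (cong suc (trans (sym uw≡b) uw≡size)))))

        b≡1+a : b ≡ suc a
        b≡1+a = trans (sym (suc-injective N[x]∖pq-size)) (cong suc (trans (sym uw≡size) uw≡a))

        three-private⇒⊥ : {z : Fin n} → Adj G x z → z ≢ p → z ≢ q → ⊥
        three-private⇒⊥ {z} xz z≢p z≢q = 1+n≰n (begin
          3 + a             ≡⟨ +-comm 3 a ⟩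
          a + 3             ≤⟨ +-monoˡ-≤ 3 a≤zx ⟩
          common G z x + 3  ≤⟨ common-+-private-≤ (count-≥3 (Private G z x) x-private u-private w-private
                                                              (u≢x ∘ sym) (w≢x ∘ sym) (Adj-≢ G uw)) ⟩
          suc b             ≡⟨ cong suc b≡1+a ⟩
          2 + a             ∎)
          where
          open ≤-Reasoning
          zx : Adj G z x
          zx = Adj-sym G xz
          x-private : Private G z x x ≡ true
          x-private = private-intro G zx (irref G x)
          u-private : Private G z x u ≡ true
          u-private = private-intro G (Adj-sym G (u-adj xz z≢p)) x≁u
          w-private : Private G z x w ≡ true
          w-private = private-intro G (Adj-sym G (w-adj xz z≢q)) x≁w
          a≤zx : a ≤ common G z x
          a≤zx with b-or-a z x (Adj-≢ G zx)
          ... | inj₁ zx≡b = subst (a ≤_) (sym (trans zx≡b b≡1+a)) (n≤1+n a)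
          ... | inj₂ zx≡a = ≤-reflexive (sym zx≡a)

      distinct-privates⇒⊥ : ⊥
      distinct-privates⇒⊥ with count N[x]∖pq in size
      ... | zero  = notSRG (2 , 0 , 1 , deza[2,1,0]⇒srg {G = G} deza[2,1,0] diameter2)
        where
        b≡1 : b ≡ 1
        b≡1 = sym (suc-injective (trans (cong (suc ∘ suc) (sym size)) N[x]∖pq-size))
        a≡0 : a ≡ 0
        a≡0 = trans (sym uw≡a) (trans uw≡size size)
        deza[2,1,0] : IsDeza G 2 1 0
        deza[2,1,0] = subst₂ (λ b a → IsDeza G (suc b) b a) b≡1 a≡0 deza
      ... | suc _ with z , z∈ ← count-witness N[x]∖pq (subst (0 <_) (sym size) (s≤s z≤n))
                  with z∈N[x]∖p , z≢q ← delete-elim (delete p (adj G x)) z∈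
                  with xz , z≢p ← delete-elim (adj G x) z∈N[x]∖p
                  = three-private⇒⊥ xz z≢p z≢q

    B-independent : ⊥
    B-independent
      with p , xp , u≁p ← private-exists xu≡b
      with q , xq , w≁q ← private-exists xw≡b
      with p ≟ q
    ... | yes refl = shared-private⇒⊥ xp u≁p w≁q
    ... | no p≢q  = distinct-privates⇒⊥ xp u≁p xq w≁q p≢q

  B[x]-coclique : IsCoclique G (inB[] G b x)
  B[x]-coclique u w u∈B[x] w∈B[x] with inB[]-elim G b x u u∈B[x] | inB[]-elim G b x w w∈B[x]
  ... | inj₁ refl | inj₁ refl = irref G x
  ... | inj₁ refl | inj₂ w∈B = typeA w w∈B
  ... | inj₂ u∈B  | inj₁ refl = trans (adj-sym G u x) (typeA u u∈B)
  ... | inj₂ u∈B  | inj₂ w∈B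
    with u≢x , ux≡b ← inB-elim G b x u u∈B
    with w≢x , wx≡b ← inB-elim G b x w w∈B
    = ¬-not (B-independent u≢x w≢x ux≡b wx≡b)

lemma6 : {n : ℕ} (G : Graph n) (k b a : ℕ)
    → IsStrictlyDeza G k b a
    → k ≡ b + 1
    → (∀ v → 1 < beta G b v)
    → (x : _) → TypeA G b x
    → IsCoclique G (inB[] G b x) × count (inB[] G b x) ≡ beta G b x + 1
lemma6 G k b a (deza , diameter2 , notSRG) k≡b+1 _ x typeA = B[x]-coclique , count-inB[] G b x
  where
  open TypeAVertex {G = G} (subst (λ k → IsDeza G k b a) (trans k≡b+1 (+-comm b 1)) deza) diameter2 notSRG x typeA
    using (B[x]-coclique)
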